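{- Let $n$ be a positive integer with binary representation $n = \sum_{k \geq 0} a_k 2^k$ (each $a_k \in \{0,1\}$, all but finitely many zero), and let $\gamma$ be the exponent of the highest power of $2$ dividing $n!$. Then $n! = 2^{\gamma} Z$, where $Z$ is odd and satisfies $$Z \equiv 3^{\alpha_3(n)} (-1)^{\alpha_5(n)} \pmod{8}.$$
   Context: For a positive integer $n = \sum_{k \geq 0} a_k 2^k$ in binary, define $\alpha_3(n) := \#\{ k \geq 0 : \sum_{i=k}^{k+2} a_i 2^{i-k} \in \{3,4\} \}$ and $\alpha_5(n) := \#\{ k \geq 0 : \sum_{i=k}^{k+2} a_i 2^{i-k} \in \{5,6\} \}$, i.e. the number of positions $k$ at which the 3-bit window $(a_{k+2}a_{k+1}a_k)_2$ has value in $\{3,4\}$, respectively $\{5,6\}$. By Legendre's formula, $\gamma = n - \sum_{k\ge 0} a_k$. -}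

module Defs where

open import Data.Nat using (ℕ; zero; suc; _+_; _*_; _^_; _/_; _%_)
open import Data.Nat using (_!)
open import Data.Nat.Divisibility using (_∣_)
open import Data.Bool using (Bool; true; false; if_then_else_; _∨_)
open import Data.Nat using (_≡ᵇ_)
open import Relation.Nullary using (¬_)
open import Data.Product using (_×_)

bit : ℕ → ℕ → ℕ
bit n zero = n % 2
bit n (suc k) = bit (n / 2) k

window : ℕ → ℕ → ℕ
window n k = bit n k + 2 * bit n (suc k) + 4 * bit n (suc (suc k))

countBelow : (ℕ → Bool) → ℕ → ℕ
countBelow p zero = zero
countBelow p (suc m) = (if p m then 1 else 0) + countBelow p m

-- All positions k with a nonzero bit satisfy k < n (since 2^k ≤ n < 2^n ... ),
-- so every nonzero window has k < n; counting k < n + 1 counts all k ≥ 0.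
α₃ : ℕ → ℕ
α₃ n = countBelow (λ k → (window n k ≡ᵇ 3) ∨ (window n k ≡ᵇ 4)) (suc n)

α₅ : ℕ → ℕ
α₅ n = countBelow (λ k → (window n k ≡ᵇ 5) ∨ (window n k ≡ᵇ 6)) (suc n)

IsTwoAdicValuation : ℕ → ℕ → Set
IsTwoAdicValuation m γ = (2 ^ γ ∣ m) × ¬ (2 ^ suc γ ∣ m)

{-# OPTIONS --safe #-}
-- Halving n splits n! as 2^⌊n/2⌋ · ⌊n/2⌋! · W(n), where W(n) is the product of the odd
-- numbers below 2⌊n/2⌋, times n when n is odd. So the odd part of n! is the odd part of
-- ⌊n/2⌋! times W(n). Four consecutive odd numbers multiply to 1 modulo 8, hence W(n) mod 8
-- depends only on n mod 8, the lowest 3-bit window of n, and the eight cases give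
-- W(n) ≡ 3^[window ∈ {3,4}] · (−1)^[window ∈ {5,6}]. The counts α₃ and α₅ obey the same
-- recursion under n ↦ ⌊n/2⌋, and the exponent is γ by uniqueness of the 2-adic valuation.
module Submission where

open import Defs
open import Data.Nat using (ℕ; suc; _*_; _^_; _≤_)
open import Data.Nat using (_!)
open import Data.Nat.Divisibility using (_∣_)
open import Data.Integer using (ℤ; +_; -[1+_])
open import Data.Integer.DivMod using (_%ℕ_)
open import Data.Product using (_×_; ∃-syntax)
open import Relation.Nullary using (¬_)
open import Relation.Binary.PropositionalEquality using (_≡_)
import Data.Integer as ℤ

open import Data.Bool using (Bool; false; if_then_else_; _∨_)
open import Data.Nat using (zero; _+_; _∸_; _<_; _%_; _/_; _≡ᵇ_; _≤′_; ≤′-reflexive; ≤′-step;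
  z≤n; s≤s; s≤s⁻¹; s<s⁻¹; NonZero)
open import Data.Nat.Properties
open import Data.Nat.DivMod
open import Data.Nat.Divisibility using (divides; m∣m*n; ∣-trans; *-cancelˡ-∣; n∣m⇒m%n≡0)
open import Data.Nat.Induction using (<-rec)
open import Data.Nat.Tactic.RingSolver using (solve-∀)
import Data.Integer.Properties as ℤP
open import Data.Product using (_,_)
open import Function using (_∘_)
open import Relation.Binary.Definitions using (tri<; tri≈; tri>)
open import Relation.Binary.PropositionalEquality using (refl; sym; trans; cong; cong₂; subst; module ≡-Reasoning)
open import Relation.Nullary using (contradiction)

open ≡-Reasoning

*-cong-% : ∀ a b c e d .{{_ : NonZero d}} → a % d ≡ b % d → c % d ≡ e % d → (a * c) % d ≡ (b * e) % d
*-cong-% a b c e d a≡b c≡e = begin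
  (a * c) % d             ≡⟨ %-distribˡ-* a c d ⟩
  (a % d * (c % d)) % d   ≡⟨ cong₂ (λ x y → (x * y) % d) a≡b c≡e ⟩
  (b % d * (e % d)) % d   ≡⟨ %-distribˡ-* b e d ⟨
  (b * e) % d             ∎

%-distribˡ-^ : ∀ m k d .{{_ : NonZero d}} → (m ^ k) % d ≡ ((m % d) ^ k) % d
%-distribˡ-^ m zero    d = refl
%-distribˡ-^ m (suc k) d = *-cong-% m (m % d) (m ^ k) ((m % d) ^ k) d (sym (m%n%n≡m%n m d)) (%-distribˡ-^ m k d)

m%[n*2]≡m%2+[m/2%n]*2 : ∀ m n → m % (suc n * 2) ≡ m % 2 + m / 2 % suc n * 2
m%[n*2]≡m%2+[m/2%n]*2 m n = begin
  m % (suc n * 2)                   ≡⟨ %-congˡ (trans (m≡m%n+[m/n]*n m 2) (+-comm (m % 2) _)) ⟩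
  (m / 2 * 2 + m % 2) % (suc n * 2) ≡⟨ [m*n+o]%[p*n]≡[m*n]%[p*n]+o (m / 2) (suc n) (m%n<n m 2) ⟩
  m / 2 * 2 % (suc n * 2) + m % 2   ≡⟨ cong (_+ m % 2) (m%n*o≡m*o%[n*o] (m / 2) (suc n) 2) ⟨
  m / 2 % suc n * 2 + m % 2         ≡⟨ +-comm _ (m % 2) ⟩
  m % 2 + m / 2 % suc n * 2         ∎

neg-%ℕ : ∀ n d .{{_ : NonZero d}} → (ℤ.- (+ n)) %ℕ d ≡ (n * (d ∸ 1)) % d
neg-%ℕ zero    (suc d) = refl
neg-%ℕ (suc n) (suc d) with suc n % suc d in eq
... | zero  = sym (begin
  (suc n * d) % suc d                   ≡⟨ %-distribˡ-* (suc n) d (suc d) ⟩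
  (suc n % suc d * (d % suc d)) % suc d ≡⟨ cong (λ r → (r * (d % suc d)) % suc d) eq ⟩
  0                                     ∎)
... | suc r = sym (begin
  (suc n * d) % suc d                   ≡⟨ %-distribˡ-* (suc n) d (suc d) ⟩
  (suc n % suc d * (d % suc d)) % suc d ≡⟨ cong₂ (λ x y → (x * y) % suc d) eq (m≤n⇒m%n≡m (≤-refl {d})) ⟩
  (suc r * d) % suc d                   ≡⟨ cong (_% suc d) (split r≤d) ⟩
  (d ∸ r + r * suc d) % suc d           ≡⟨ [m+kn]%n≡m%n (d ∸ r) r (suc d) ⟩
  (d ∸ r) % suc d                       ≡⟨ m≤n⇒m%n≡m (m∸n≤m d r) ⟩
  d ∸ r                                 ∎)
  where
  r≤d : r ≤ d
  r≤d = <⇒≤ (s<s⁻¹ (subst (_< suc d) eq (m%n<n (suc n) (suc d))))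
  split : ∀ {r d} → r ≤ d → suc r * d ≡ d ∸ r + r * suc d
  split {r} r≤d with t , refl ← m≤n⇒∃[o]m+o≡n r≤d =
    trans (identity r t) (cong (_+ r * suc (r + t)) (sym (m+n∸m≡n r t)))
    where
    identity : ∀ r t → suc r * (r + t) ≡ t + r * suc (r + t)
    identity = solve-∀

pos-^ : ∀ m k → + (m ^ k) ≡ (+ m) ℤ.^ k
pos-^ m zero    = refl
pos-^ m (suc k) = trans (ℤP.pos-* m (m ^ k)) (cong (+ m ℤ.*_) (pos-^ m k))

indicator : Bool → ℕ
indicator b = if b then 1 else 0

countBelow-suc : ∀ p m → countBelow p (suc m) ≡ countBelow (p ∘ suc) m + indicator (p 0)
countBelow-suc p zero    = +-identityʳ _
countBelow-suc p (suc m) = begin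
  indicator (p (suc m)) + countBelow p (suc m)
    ≡⟨ cong (_+_ (indicator (p (suc m)))) (countBelow-suc p m) ⟩
  indicator (p (suc m)) + (countBelow (p ∘ suc) m + indicator (p 0))
    ≡⟨ +-assoc (indicator (p (suc m))) _ _ ⟨
  countBelow (p ∘ suc) (suc m) + indicator (p 0)
    ∎

countBelow-stable : ∀ {p b m} → (∀ k → b ≤ k → p k ≡ false) → b ≤ m → countBelow p m ≡ countBelow p b
countBelow-stable {p} {b} vanish b≤m = go (≤⇒≤′ b≤m)
  where
  go : ∀ {m} → b ≤′ m → countBelow p m ≡ countBelow p b
  go (≤′-reflexive refl) = refl
  go (≤′-step b≤′m)      = cong₂ _+_ (cong indicator (vanish _ (≤′⇒≤ b≤′m))) (go b≤′m)

bit-vanishes : ∀ {n} k → n ≤ k → bit n k ≡ 0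
bit-vanishes {zero}  zero    _      = refl
bit-vanishes {n}     (suc k) n≤1+k  = bit-vanishes k (half-≤ n n≤1+k)
  where
  half-≤ : ∀ n → n ≤ suc k → n / 2 ≤ k
  half-≤ zero    _     = z≤n
  half-≤ (suc n) n≤1+k = s≤s⁻¹ (≤-trans (m/n<m (suc n) 2 (s≤s (s≤s z≤n))) n≤1+k)

window-vanishes : ∀ {n} k → n ≤ k → window n k ≡ 0
window-vanishes k n≤k
  rewrite bit-vanishes k n≤k
        | bit-vanishes (suc k) (m≤n⇒m≤1+n n≤k)
        | bit-vanishes (suc (suc k)) (m≤n⇒m≤1+n (m≤n⇒m≤1+n n≤k)) = refl

window-zero : ∀ n → window n 0 ≡ n % 8
window-zero n = sym (begin
  n % 8                                       ≡⟨ m%[n*2]≡m%2+[m/2%n]*2 n 3 ⟩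
  n % 2 + n / 2 % 4 * 2                       ≡⟨ cong (λ x → n % 2 + x * 2) (m%[n*2]≡m%2+[m/2%n]*2 (n / 2) 1) ⟩
  n % 2 + (n / 2 % 2 + n / 2 / 2 % 2 * 2) * 2 ≡⟨ regroup (n % 2) (n / 2 % 2) (n / 2 / 2 % 2) ⟩
  window n 0                                  ∎)
  where
  regroup : ∀ a b c → a + (b + c * 2) * 2 ≡ a + 2 * b + 4 * c
  regroup = solve-∀

windowCount : (ℕ → Bool) → ℕ → ℕ
windowCount p n = countBelow (λ k → p (window n k)) (suc n)

windowCount-half : ∀ {p} → p 0 ≡ false → ∀ n →
  windowCount p n ≡ windowCount p (n / 2) + indicator (p (n % 8))
windowCount-half {p} p0≡false n = begin
  windowCount p n
    ≡⟨ countBelow-suc (λ k → p (window n k)) n ⟩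
  countBelow (λ k → p (window (n / 2) k)) n + indicator (p (window n 0))
    ≡⟨ cong₂ _+_ (trans (countBelow-stable vanish (m/n≤m n 2)) (sym (countBelow-stable vanish (n≤1+n _))))
                 (cong (indicator ∘ p) (window-zero n)) ⟩
  windowCount p (n / 2) + indicator (p (n % 8))
    ∎
  where
  vanish : ∀ k → n / 2 ≤ k → p (window (n / 2) k) ≡ false
  vanish k le rewrite window-vanishes k le = p0≡false

is3∨4 is5∨6 : ℕ → Bool
is3∨4 w = (w ≡ᵇ 3) ∨ (w ≡ᵇ 4)
is5∨6 w = (w ≡ᵇ 5) ∨ (w ≡ᵇ 6)

α₃-half : ∀ n → α₃ n ≡ α₃ (n / 2) + indicator (is3∨4 (n % 8))
α₃-half = windowCount-half {is3∨4} refl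

α₅-half : ∀ n → α₅ n ≡ α₅ (n / 2) + indicator (is5∨6 (n % 8))
α₅-half = windowCount-half {is5∨6} refl

oddProduct : ℕ → ℕ
oddProduct zero    = 1
oddProduct (suc m) = (1 + 2 * m) * oddProduct m

factorial-even : ∀ m → (2 * m) ! ≡ 2 ^ m * (m ! * oddProduct m)
factorial-even zero    = refl
factorial-even (suc m) = begin
  (2 * suc m) !
    ≡⟨ cong _! (double-suc m) ⟩
  (2 + 2 * m) * ((1 + 2 * m) * (2 * m) !)
    ≡⟨ cong (λ x → (2 + 2 * m) * ((1 + 2 * m) * x)) (factorial-even m) ⟩
  (2 + 2 * m) * ((1 + 2 * m) * (2 ^ m * (m ! * oddProduct m)))
    ≡⟨ regroup m (2 ^ m) (m !) (oddProduct m) ⟩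
  2 ^ suc m * (suc m ! * oddProduct (suc m))
    ∎
  where
  double-suc : ∀ m → 2 * suc m ≡ 2 + 2 * m
  double-suc = solve-∀
  regroup : ∀ m a b c → (2 + 2 * m) * ((1 + 2 * m) * (a * (b * c))) ≡ (2 * a) * ((suc m * b) * ((1 + 2 * m) * c))
  regroup = solve-∀

factorial-split : ∀ m r → r ≤ 1 → (r + 2 * m) ! ≡ 2 ^ m * (m ! * (oddProduct m * (r + 2 * m) ^ r))
factorial-split m zero _ = begin
  (2 * m) !                           ≡⟨ factorial-even m ⟩
  2 ^ m * (m ! * oddProduct m)        ≡⟨ cong (λ x → 2 ^ m * (m ! * x)) (*-identityʳ (oddProduct m)) ⟨
  2 ^ m * (m ! * (oddProduct m * 1))  ∎
factorial-split m (suc zero) _ = begin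
  (1 + 2 * m) * (2 * m) !                            ≡⟨ cong ((1 + 2 * m) *_) (factorial-even m) ⟩
  (1 + 2 * m) * (2 ^ m * (m ! * oddProduct m))       ≡⟨ regroup m (2 ^ m) (m !) (oddProduct m) ⟩
  2 ^ m * (m ! * (oddProduct m * ((1 + 2 * m) * 1))) ∎
  where
  regroup : ∀ m a b c → (1 + 2 * m) * (a * (b * c)) ≡ a * (b * (c * ((1 + 2 * m) * 1)))
  regroup = solve-∀
factorial-split m (suc (suc r)) (s≤s ())

oddFactor : ℕ → ℕ
oddFactor n = oddProduct (n / 2) * n ^ (n % 2)

factorial-halving : ∀ n → n ! ≡ 2 ^ (n / 2) * ((n / 2) ! * oddFactor n)
factorial-halving n =
  subst (λ x → x ! ≡ 2 ^ (n / 2) * ((n / 2) ! * (oddProduct (n / 2) * x ^ (n % 2))))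
        (sym (trans (m≡m%n+[m/n]*n n 2) (cong (_+_ (n % 2)) (*-comm (n / 2) 2))))
        (factorial-split (n / 2) (n % 2) (s≤s⁻¹ (m%n<n n 2)))

-- (2m+1)(2m+3)(2m+5)(2m+7) ≡ 1 (mod 8)
oddProduct-periodic : ∀ m → oddProduct (4 + m) % 8 ≡ oddProduct m % 8
oddProduct-periodic m = begin
  oddProduct (4 + m) % 8                      ≡⟨ cong (_% 8) (expand m (oddProduct m)) ⟩
  (oddProduct m + oddProduct m * q m * 8) % 8 ≡⟨ [m+kn]%n≡m%n (oddProduct m) (oddProduct m * q m) 8 ⟩
  oddProduct m % 8                            ∎
  where
  q : ℕ → ℕ
  q m = 2 * m * m * m * m + 16 * m * m * m + 43 * m * m + 44 * m + 13
  expand : ∀ m x → (1 + 2 * (3 + m)) * ((1 + 2 * (2 + m)) * ((1 + 2 * (1 + m)) * ((1 + 2 * m) * x)))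
                   ≡ x + x * (2 * m * m * m * m + 16 * m * m * m + 43 * m * m + 44 * m + 13) * 8
  expand = solve-∀

oddProduct-mod8 : ∀ m → oddProduct m % 8 ≡ oddProduct (m % 4) % 8
oddProduct-mod8 0 = refl
oddProduct-mod8 1 = refl
oddProduct-mod8 2 = refl
oddProduct-mod8 3 = refl
oddProduct-mod8 (suc (suc (suc (suc m)))) = trans (oddProduct-periodic m) (oddProduct-mod8 m)

oddFactor-mod8 : ∀ n → oddFactor n % 8 ≡ oddFactor (n % 8) % 8
oddFactor-mod8 n =
  *-cong-% (oddProduct (n / 2)) (oddProduct (n % 8 / 2)) (n ^ (n % 2)) ((n % 8) ^ (n % 8 % 2)) 8 half power
  where
  half : oddProduct (n / 2) % 8 ≡ oddProduct (n % 8 / 2) % 8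
  half = trans (oddProduct-mod8 (n / 2)) (cong (λ m → oddProduct m % 8) (sym (m%[n*o]/o≡m/o%n n 4 2)))
  power : n ^ (n % 2) % 8 ≡ (n % 8) ^ (n % 8 % 2) % 8
  power = trans (%-distribˡ-^ n (n % 2) 8)
                (cong (λ k → (n % 8) ^ k % 8) (sym (m∣n⇒o%n%m≡o%m 2 8 n (divides 4 refl))))

-- 7 represents −1 modulo 8
unit₈ : ℕ → ℕ → ℕ
unit₈ a b = 3 ^ a * 7 ^ b

unit₈-+ : ∀ a b c d → unit₈ a b * unit₈ c d ≡ unit₈ (a + c) (b + d)
unit₈-+ a b c d = begin
  3 ^ a * 7 ^ b * (3 ^ c * 7 ^ d)     ≡⟨ [m*n]*[o*p]≡[m*o]*[n*p] (3 ^ a) (7 ^ b) (3 ^ c) (7 ^ d) ⟩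
  3 ^ a * 3 ^ c * (7 ^ b * 7 ^ d)     ≡⟨ cong₂ _*_ (^-distribˡ-+-* 3 a c) (^-distribˡ-+-* 7 b d) ⟨
  3 ^ (a + c) * 7 ^ (b + d)           ∎

unit₈-odd : ∀ a b → unit₈ a b % 2 ≡ 1
unit₈-odd a b = begin
  (3 ^ a * 7 ^ b) % 2 ≡⟨ *-cong-% (3 ^ a) (1 ^ a) (7 ^ b) (1 ^ b) 2 (%-distribˡ-^ 3 a 2) (%-distribˡ-^ 7 b 2) ⟩
  (1 ^ a * 1 ^ b) % 2 ≡⟨ cong₂ (λ x y → (x * y) % 2) (^-zeroˡ a) (^-zeroˡ b) ⟩
  1                   ∎

¬2∣-unit₈-class : ∀ {z} a b → z % 8 ≡ unit₈ a b % 8 → ¬ (2 ∣ z)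
¬2∣-unit₈-class {z} a b z≡u 2∣z = 0≢1+n (begin
  0                  ≡⟨ n∣m⇒m%n≡0 z 2 2∣z ⟨
  z % 2              ≡⟨ m∣n⇒o%n%m≡o%m 2 8 z (divides 4 refl) ⟨
  z % 8 % 2          ≡⟨ cong (_% 2) z≡u ⟩
  unit₈ a b % 8 % 2  ≡⟨ m∣n⇒o%n%m≡o%m 2 8 (unit₈ a b) (divides 4 refl) ⟩
  unit₈ a b % 2      ≡⟨ unit₈-odd a b ⟩
  1                  ∎)

oddFactor-unit₈ : ∀ n → oddFactor n % 8 ≡ unit₈ (indicator (is3∨4 (n % 8))) (indicator (is5∨6 (n % 8))) % 8
oddFactor-unit₈ n = trans (oddFactor-mod8 n) (table (n % 8) (m%n<n n 8))
  where
  table : ∀ r → r < 8 → oddFactor r % 8 ≡ unit₈ (indicator (is3∨4 r)) (indicator (is5∨6 r)) % 8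
  table 0 _ = refl
  table 1 _ = refl
  table 2 _ = refl
  table 3 _ = refl
  table 4 _ = refl
  table 5 _ = refl
  table 6 _ = refl
  table 7 _ = refl
  table (suc (suc (suc (suc (suc (suc (suc (suc _)))))))) (s≤s (s≤s (s≤s (s≤s (s≤s (s≤s (s≤s (s≤s ()))))))))

unit₈-%ℕ : ∀ a b → unit₈ a b % 8 ≡ ((+ 3) ℤ.^ a ℤ.* -[1+ 0 ] ℤ.^ b) %ℕ 8
unit₈-%ℕ a zero = begin
  (3 ^ a * 1) % 8              ≡⟨ cong (_% 8) (*-identityʳ (3 ^ a)) ⟩
  + (3 ^ a) %ℕ 8               ≡⟨ cong (_%ℕ 8) (trans (pos-^ 3 a) (sym (ℤP.*-identityʳ _))) ⟩
  ((+ 3) ℤ.^ a ℤ.* + 1) %ℕ 8   ∎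
unit₈-%ℕ a (suc zero) = begin
  (3 ^ a * (7 * 1)) % 8          ≡⟨ cong (λ x → (3 ^ a * x) % 8) (*-identityʳ 7) ⟩
  (3 ^ a * 7) % 8                ≡⟨ neg-%ℕ (3 ^ a) 8 ⟨
  (ℤ.- + (3 ^ a)) %ℕ 8           ≡⟨ cong (λ x → ℤ.- x %ℕ 8) (pos-^ 3 a) ⟩
  (ℤ.- (+ 3) ℤ.^ a) %ℕ 8
    ≡⟨ cong (_%ℕ 8) (trans (ℤP.*-comm ((+ 3) ℤ.^ a) -[1+ 0 ]) (ℤP.-1*i≡-i ((+ 3) ℤ.^ a))) ⟨
  ((+ 3) ℤ.^ a ℤ.* -[1+ 0 ]) %ℕ 8 ∎
unit₈-%ℕ a (suc (suc b)) = begin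
  (3 ^ a * (7 * (7 * 7 ^ b))) % 8                   ≡⟨ cong (_% 8) (expand (3 ^ a) (7 ^ b)) ⟩
  (unit₈ a b + 6 * unit₈ a b * 8) % 8               ≡⟨ [m+kn]%n≡m%n (unit₈ a b) (6 * unit₈ a b) 8 ⟩
  unit₈ a b % 8                                     ≡⟨ unit₈-%ℕ a b ⟩
  ((+ 3) ℤ.^ a ℤ.* -[1+ 0 ] ℤ.^ b) %ℕ 8
    ≡⟨ cong (λ x → ((+ 3) ℤ.^ a ℤ.* x) %ℕ 8) (square-cancel (-[1+ 0 ] ℤ.^ b)) ⟨
  ((+ 3) ℤ.^ a ℤ.* -[1+ 0 ] ℤ.^ suc (suc b)) %ℕ 8  ∎
  where
  expand : ∀ x y → x * (7 * (7 * y)) ≡ x * y + 6 * (x * y) * 8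
  expand = solve-∀
  square-cancel : ∀ i → -[1+ 0 ] ℤ.* (-[1+ 0 ] ℤ.* i) ≡ i
  square-cancel i = trans (cong (-[1+ 0 ] ℤ.*_) (ℤP.-1*i≡-i i))
                          (trans (ℤP.-1*i≡-i (ℤ.- i)) (ℤP.neg-involutive i))

^-monoʳ-∣ : ∀ m {a b} → a ≤ b → m ^ a ∣ m ^ b
^-monoʳ-∣ m {a} a≤b with k , refl ← m≤n⇒∃[o]m+o≡n a≤b =
  subst (m ^ a ∣_) (sym (^-distribˡ-+-* m a k)) (m∣m*n (m ^ k))

valuation-unique : ∀ {m γ δ} → IsTwoAdicValuation m γ → IsTwoAdicValuation m δ → γ ≡ δ
valuation-unique {γ = γ} {δ} (2^γ∣m , 2^1+γ∤m) (2^δ∣m , 2^1+δ∤m) with <-cmp γ δ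
... | tri< γ<δ _ _ = contradiction (∣-trans (^-monoʳ-∣ 2 γ<δ) 2^δ∣m) 2^1+γ∤m
... | tri≈ _ γ≡δ _ = γ≡δ
... | tri> _ _ δ<γ = contradiction (∣-trans (^-monoʳ-∣ 2 δ<γ) 2^γ∣m) 2^1+δ∤m

valuation-of-odd-multiple : ∀ e {z} → ¬ (2 ∣ z) → IsTwoAdicValuation (2 ^ e * z) e
valuation-of-odd-multiple e {z} 2∤z =
  m∣m*n z , λ 2^1+e∣ →
    2∤z (*-cancelˡ-∣ (2 ^ e) {{m^n≢0 2 e}} (subst (_∣ 2 ^ e * z) (*-comm 2 (2 ^ e)) 2^1+e∣))

record OddPartMod8 (n : ℕ) : Set where
  field
    exponent oddPart : ℕ
    factorial≡       : n ! ≡ 2 ^ exponent * oddPart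
    oddPart≡         : oddPart % 8 ≡ unit₈ (α₃ n) (α₅ n) % 8

oddPartMod8-half : ∀ n → OddPartMod8 (n / 2) → OddPartMod8 n
oddPartMod8-half n h = record
  { exponent   = n / 2 + exponent
  ; oddPart    = oddPart * oddFactor n
  ; factorial≡ = begin
      n !
        ≡⟨ factorial-halving n ⟩
      2 ^ (n / 2) * ((n / 2) ! * oddFactor n)
        ≡⟨ cong (λ x → 2 ^ (n / 2) * (x * oddFactor n)) factorial≡ ⟩
      2 ^ (n / 2) * (2 ^ exponent * oddPart * oddFactor n)
        ≡⟨ regroup (2 ^ (n / 2)) (2 ^ exponent) oddPart (oddFactor n) ⟩
      2 ^ (n / 2) * 2 ^ exponent * (oddPart * oddFactor n)
        ≡⟨ cong (_* (oddPart * oddFactor n)) (^-distribˡ-+-* 2 (n / 2) exponent) ⟨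
      2 ^ (n / 2 + exponent) * (oddPart * oddFactor n)
        ∎
  ; oddPart≡   = begin
      (oddPart * oddFactor n) % 8
        ≡⟨ *-cong-% oddPart (unit₈ a b) (oddFactor n) (unit₈ i j) 8 oddPart≡ (oddFactor-unit₈ n) ⟩
      (unit₈ a b * unit₈ i j) % 8
        ≡⟨ cong (_% 8) (unit₈-+ a b i j) ⟩
      unit₈ (a + i) (b + j) % 8
        ≡⟨ cong₂ (λ a b → unit₈ a b % 8) (α₃-half n) (α₅-half n) ⟨
      unit₈ (α₃ n) (α₅ n) % 8
        ∎
  }
  where
  open OddPartMod8 h
  a b i j : ℕ
  a = α₃ (n / 2)
  b = α₅ (n / 2)
  i = indicator (is3∨4 (n % 8))
  j = indicator (is5∨6 (n % 8))
  regroup : ∀ a b z w → a * (b * z * w) ≡ a * b * (z * w)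
  regroup = solve-∀

oddPartMod8 : ∀ n → OddPartMod8 n
oddPartMod8 = <-rec OddPartMod8 step
  where
  step : ∀ n → (∀ {m} → m < n → OddPartMod8 m) → OddPartMod8 n
  step zero      _   = record { exponent = 0 ; oddPart = 1 ; factorial≡ = refl ; oddPart≡ = refl }
  step n@(suc _) rec = oddPartMod8-half n (rec (m/n<m n 2 (s≤s (s≤s z≤n))))

theorem8 : ∀ (n : ℕ) → 1 ≤ n → ∀ (γ : ℕ) → IsTwoAdicValuation (n !) γ →
    ∃[ Z ] ((n ! ≡ 2 ^ γ * Z) × ¬ (2 ∣ Z) ×
      ((+ Z) %ℕ 8 ≡ (((+ 3) ℤ.^ α₃ n) ℤ.* ((-[1+ 0 ]) ℤ.^ α₅ n)) %ℕ 8))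
theorem8 n _ γ γ-valuation =
  oddPart , subst (λ g → n ! ≡ 2 ^ g * oddPart) exponent≡γ factorial≡ , oddPart-odd ,
  trans oddPart≡ (unit₈-%ℕ (α₃ n) (α₅ n))
  where
  open OddPartMod8 (oddPartMod8 n)
  oddPart-odd : ¬ (2 ∣ oddPart)
  oddPart-odd = ¬2∣-unit₈-class (α₃ n) (α₅ n) oddPart≡
  exponent≡γ : exponent ≡ γ
  exponent≡γ = valuation-unique
    (subst (λ m → IsTwoAdicValuation m exponent) (sym factorial≡) (valuation-of-odd-multiple exponent oddPart-odd))
    γ-valuation
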